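{- Let $D$ be a skew field of finite dimension over $\mathbb{Q}$ with centre $F$, $n\geq 2$, and let $\Sigma$ be as described in the context. Let $P\in\mathrm{GL}_n(D)$, $\sigma\in\Sigma$ and $k\in\{1,\dots,n-1\}$. If $P\sigma(V)=V$ for every right $D$-vector subspace $V$ of $D^n$ of dimension $k$, then $P$ is a central homothety (i.e. $P=\lambda I$ with $\lambda\in F^{\times}$) and $\sigma$ is the identity.
   Context: Every automorphism $\theta$ of $D$ extends to an automorphism $\mathrm{Ext}\,\theta$ of $\mathrm{M}_n(D)$ acting entrywise. $\Sigma$ is a set of automorphisms of $\mathrm{M}_n(D)$ containing, for each automorphism $\sigma_0$ of $F$ in the image of the restriction map $\mathrm{Aut}_{\mathbb{Q}}\mathrm{M}_n(D)\to\mathrm{Aut}_{\mathbb{Q}}F$, exactly one element restricting to $\sigma_0$ on $F$, this element being of the form $\mathrm{Ext}\,\theta$ for an automorphism $\theta$ of $D$; the representative chosen for $\sigma_0=\mathrm{id}_F$ is the identity of $\mathrm{M}_n(D)$. For $\sigma=\mathrm{Ext}\,\theta\in\Sigma$ and a subspace $V\subset D^n$, $\sigma(V)$ is the image of $V$ under applying $\theta$ coordinatewise, and $P\sigma(V)=\{P\sigma(v):v\in V\}$ with $P$ acting on column vectors on the left. -}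

module Defs where

open import Level using (Level; _⊔_) renaming (suc to lsuc)
open import Algebra.Bundles using (Ring; RawRing)
open import Algebra.Morphism.Structures using (module RingMorphisms)
open import Data.Nat using (ℕ; zero; suc)
open import Data.Fin using (Fin; zero; suc; _≟_)
open import Data.Integer using (ℤ; +_; -[1+_])
open import Data.Rational using (ℚ; ↥_; ↧ₙ_)
open import Data.Product using (Σ; _×_; _,_)
open import Function using (_∘_)
open import Relation.Nullary using (¬_; yes; no)
open import Relation.Unary using (Pred; _∈_)

record DivisionRing c ℓ : Set (lsuc (c ⊔ ℓ)) where
  field
    ring : Ring c ℓ
  open Ring ring public
  field
    _⁻¹      : Carrier → Carrier
    1≉0      : ¬ (1# ≈ 0#)
    inverseʳ : ∀ x → ¬ (x ≈ 0#) → x * (x ⁻¹) ≈ 1#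
    inverseˡ : ∀ x → ¬ (x ≈ 0#) → (x ⁻¹) * x ≈ 1#

module _ {c ℓ} (D : DivisionRing c ℓ) where
  open DivisionRing D hiding (zero)

  sumF : ∀ {m} → (Fin m → Carrier) → Carrier
  sumF {zero}  f = 0#
  sumF {suc m} f = f zero + sumF (f ∘ suc)

  natCast : ℕ → Carrier
  natCast zero    = 0#
  natCast (suc m) = 1# + natCast m

  intCast : ℤ → Carrier
  intCast (+ m)     = natCast m
  intCast -[1+ m ]  = - natCast (suc m)

  ιℚ : ℚ → Carrier
  ιℚ q = intCast (↥ q) * (natCast (↧ₙ q) ⁻¹)

  CharZero : Set ℓ
  CharZero = ∀ m → ¬ (natCast (suc m) ≈ 0#)

  FinDimOverℚ : Set (c ⊔ ℓ)
  FinDimOverℚ = CharZero ×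
    Σ ℕ λ m → Σ (Fin m → Carrier) λ e →
      ∀ x → Σ (Fin m → ℚ) λ a → x ≈ sumF (λ i → ιℚ (a i) * e i)

  Central : Carrier → Set (c ⊔ ℓ)
  Central x = ∀ y → x * y ≈ y * x

  Vect : ℕ → Set c
  Vect n = Fin n → Carrier

  Mat : ℕ → Set c
  Mat n = Fin n → Fin n → Carrier

  _≈M_ : ∀ {n} → Mat n → Mat n → Set ℓ
  A ≈M B = ∀ i j → A i j ≈ B i j

  _*M_ : ∀ {n} → Mat n → Mat n → Mat n
  (A *M B) i j = sumF (λ l → A i l * B l j)

  scalarM : ∀ {n} → Carrier → Mat n
  scalarM x i j with i ≟ j
  ... | yes _ = x
  ... | no _  = 0#

  idM : ∀ {n} → Mat n
  idM = scalarM 1#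

  applyM : ∀ {n} → Mat n → Vect n → Vect n
  applyM P v i = sumF (λ l → P i l * v l)

  IsInvertible : ∀ {n} → Mat n → Set (c ⊔ ℓ)
  IsInvertible P = Σ (Mat _) λ Q → ((P *M Q) ≈M idM) × ((Q *M P) ≈M idM)

  matRawRing : ℕ → RawRing c ℓ
  matRawRing n = record
    { Carrier = Mat n
    ; _≈_ = _≈M_
    ; _+_ = λ A B i j → A i j + B i j
    ; _*_ = _*M_
    ; -_ = λ A i j → - A i j
    ; 0# = λ _ _ → 0#
    ; 1# = idM
    }

  -- automorphisms of D and of M_n(D)  (ring automorphisms; they are
  -- automatically ℚ-linear)
  IsAutD : (Carrier → Carrier) → Set (c ⊔ ℓ)
  IsAutD θ = RingMorphisms.IsRingIsomorphism rawRing rawRing θ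

  IsAutM : (n : ℕ) → (Mat n → Mat n) → Set (c ⊔ ℓ)
  IsAutM n φ = RingMorphisms.IsRingIsomorphism (matRawRing n) (matRawRing n) φ

  Ext : ∀ {n} → (Carrier → Carrier) → Mat n → Mat n
  Ext θ A i j = θ (A i j)

  -- The set Σ, represented by the set S of automorphisms θ of D such that
  -- Σ = { Ext θ : θ ∈ S }.  The restriction of an automorphism φ of M_n(D)
  -- to F (identified with the centre F·I of M_n(D)) is λ ↦ φ(λ I).
  record IsSigma {s} (n : ℕ) (S : Pred (Carrier → Carrier) s) : Set (c ⊔ ℓ ⊔ s) where
    field
      isAut   : ∀ θ → θ ∈ S → IsAutD θ
      -- every σ₀ in the image of the restriction map has a representative in Σ
      covers  : ∀ φ → IsAutM n φ →
                Σ (Carrier → Carrier) λ θ → θ ∈ S ×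
                  (∀ x → Central x → (φ (scalarM x)) ≈M (Ext θ (scalarM x)))
      -- ... and exactly one
      unique  : ∀ θ₁ θ₂ → θ₁ ∈ S → θ₂ ∈ S →
                (∀ x → Central x → θ₁ x ≈ θ₂ x) →
                ∀ (A : Mat n) → (Ext θ₁ A) ≈M (Ext θ₂ A)
      -- the representative of id_F is the identity of M_n(D)
      idInS   : (λ x → x) ∈ S

  record IsSubspace {n : ℕ} (V : Pred (Vect n) (c ⊔ ℓ)) : Set (c ⊔ ℓ) where
    field
      resp  : ∀ {u v} → (∀ i → u i ≈ v i) → u ∈ V → v ∈ V
      zero∈ : (λ _ → 0#) ∈ V
      +∈    : ∀ {u v} → u ∈ V → v ∈ V → (λ i → u i + v i) ∈ V
      *∈    : ∀ {v} a → v ∈ V → (λ i → v i * a) ∈ V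

  HasDim : ∀ {n} → ℕ → Pred (Vect n) (c ⊔ ℓ) → Set (c ⊔ ℓ)
  HasDim {n} k V = Σ (Fin k → Vect n) λ b →
    (∀ j → b j ∈ V) ×
    (∀ (a : Fin k → Carrier) → (∀ i → sumF (λ j → b j i * a j) ≈ 0#) → ∀ j → a j ≈ 0#) ×
    (∀ v → v ∈ V → Σ (Fin k → Carrier) λ a → ∀ i → v i ≈ sumF (λ j → b j i * a j))

  StableUnder : ∀ {n} → Mat n → (Carrier → Carrier) → Pred (Vect n) (c ⊔ ℓ) → Set (c ⊔ ℓ)
  StableUnder P θ V =
    (∀ v → v ∈ V → applyM P (θ ∘ v) ∈ V) ×
    (∀ w → w ∈ V → Σ (Vect _) λ v → v ∈ V × (∀ i → applyM P (θ ∘ v) i ≈ w i))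

  IsCentralHomothety : ∀ {n} → Mat n → Set (c ⊔ ℓ)
  IsCentralHomothety P = Σ Carrier λ x → Central x × ¬ (x ≈ 0#) × (P ≈M scalarM x)

{-# OPTIONS --safe #-}
-- Take two coordinates i ≠ j and a ∈ D. A k-dimensional subspace spanned by
-- e_j + e_i a and k - 1 further unit vectors e_l (l ≠ i, j) consists of vectors
-- whose i-th coordinate is a times the j-th one. Its stability under P σ,
-- tested on P σ(e_j + e_i a) = P e_j + P e_i θ(a), gives
--   P_ij + P_ii θ(a) = a (P_jj + P_ji θ(a)).
-- With a = 0 this says P is diagonal, with a = 1 that its diagonal is a
-- constant μ, and then μ θ(a) = a μ for all a. Since μ ≠ 0, θ fixes the
-- centre, so σ = id by the uniqueness in Σ; then μ commutes with everything.
module Submission where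

open import Defs
open import Algebra.Morphism.Structures using (module RingMorphisms)
open import Data.Empty using (⊥-elim)
open import Data.Fin using (Fin; zero; suc; _≟_; punchIn; punchOut; inject≤)
open import Data.Fin.Properties
  using (suc-injective; punchIn-injective; punchInᵢ≢i; punchIn-punchOut; inject≤-injective)
open import Data.Nat using (ℕ; _≤_; _<_; s≤s; z≤n)
open import Data.Product using (Σ; _×_; _,_; proj₁)
open import Function using (_∘_)
open import Function.Definitions using (Injective)
open import Level using (_⊔_)
open import Relation.Binary.PropositionalEquality using (_≡_; _≢_; refl; sym; cong)
open import Relation.Nullary using (¬_; Dec; yes; no)
open import Relation.Unary using (Pred; _∈_)
import Algebra.Properties.CommutativeSemigroup as CommSemigroupProperties
import Relation.Binary.Reasoning.Setoid as SetoidReasoning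

module _ {c ℓ} (D : DivisionRing c ℓ) where
  open DivisionRing D hiding (zero) renaming (refl to ≈-refl; sym to ≈-sym; trans to ≈-trans)
  open CommSemigroupProperties +-commutativeSemigroup using (interchange)
  open SetoidReasoning setoid

  private
    variable
      m k : ℕ

  sumF-cong : {f g : Fin m → Carrier} → (∀ l → f l ≈ g l) → sumF D f ≈ sumF D g
  sumF-cong {ℕ.zero}  f≈g = ≈-refl
  sumF-cong {ℕ.suc m} f≈g = +-cong (f≈g zero) (sumF-cong (f≈g ∘ suc))

  sumF-zero : {f : Fin m → Carrier} → (∀ l → f l ≈ 0#) → sumF D f ≈ 0#
  sumF-zero {ℕ.zero}  f≈0 = ≈-refl
  sumF-zero {ℕ.suc m} f≈0 = ≈-trans (+-cong (f≈0 zero) (sumF-zero (f≈0 ∘ suc))) (+-identityˡ 0#)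

  sumF-distrib-+ : (f g : Fin m → Carrier) → sumF D (λ l → f l + g l) ≈ sumF D f + sumF D g
  sumF-distrib-+ {ℕ.zero}  f g = ≈-sym (+-identityˡ 0#)
  sumF-distrib-+ {ℕ.suc m} f g =
    ≈-trans (+-congˡ (sumF-distrib-+ (f ∘ suc) (g ∘ suc))) (interchange _ _ _ _)

  sumF-distribʳ-* : (f : Fin m → Carrier) (x : Carrier) → sumF D (λ l → f l * x) ≈ sumF D f * x
  sumF-distribʳ-* {ℕ.zero}  f x = ≈-sym (zeroˡ x)
  sumF-distribʳ-* {ℕ.suc m} f x =
    ≈-trans (+-congˡ (sumF-distribʳ-* (f ∘ suc) x)) (≈-sym (distribʳ x _ _))

  sumF-single : (f : Fin m → Carrier) (j : Fin m) → (∀ l → l ≢ j → f l ≈ 0#) → sumF D f ≈ f j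
  sumF-single f zero    f≈0 =
    ≈-trans (+-congˡ (sumF-zero (λ l → f≈0 (suc l) (λ ())))) (+-identityʳ _)
  sumF-single f (suc j) f≈0 =
    ≈-trans (+-congʳ (f≈0 zero (λ ())))
      (≈-trans (+-identityˡ _) (sumF-single (f ∘ suc) j (λ l l≢j → f≈0 (suc l) (l≢j ∘ suc-injective))))

  idM-diag : (i : Fin m) → idM D i i ≈ 1#
  idM-diag i with i ≟ i
  ... | yes _   = ≈-refl
  ... | no  i≢i = ⊥-elim (i≢i refl)

  idM-offdiag : {i j : Fin m} → i ≢ j → idM D i j ≈ 0#
  idM-offdiag {i = i} {j} i≢j with i ≟ j
  ... | yes i≡j = ⊥-elim (i≢j i≡j)
  ... | no  _   = ≈-refl

  idM-reindex : {g : Fin k → Fin m} → Injective _≡_ _≡_ g → ∀ t u → idM D (g t) (g u) ≈ idM D t u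
  idM-reindex {g = g} g-inj t u = reindex (t ≟ u)
    where
    reindex : Dec (t ≡ u) → idM D (g t) (g u) ≈ idM D t u
    reindex (yes refl) = ≈-trans (idM-diag (g t)) (≈-sym (idM-diag t))
    reindex (no t≢u)   = ≈-trans (idM-offdiag (t≢u ∘ g-inj)) (≈-sym (idM-offdiag t≢u))

  sumF-*-idM : (f : Fin m → Carrier) (j : Fin m) → sumF D (λ l → f l * idM D j l) ≈ f j
  sumF-*-idM f j = begin
    sumF D (λ l → f l * idM D j l)  ≈⟨ sumF-single _ j (λ l l≢j → ≈-trans (*-congˡ (idM-offdiag (l≢j ∘ sym))) (zeroʳ _)) ⟩
    f j * idM D j j                  ≈⟨ *-congˡ (idM-diag j) ⟩
    f j * 1#                         ≈⟨ *-identityʳ _ ⟩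
    f j                              ∎

  sumF-idM-* : (f : Fin m → Carrier) (j : Fin m) → sumF D (λ l → idM D l j * f l) ≈ f j
  sumF-idM-* f j = begin
    sumF D (λ l → idM D l j * f l)  ≈⟨ sumF-single _ j (λ l l≢j → ≈-trans (*-congʳ (idM-offdiag l≢j)) (zeroˡ _)) ⟩
    idM D j j * f j                  ≈⟨ *-congʳ (idM-diag j) ⟩
    1# * f j                         ≈⟨ *-identityˡ _ ⟩
    f j                              ∎

  scalarM-fromDiagonal : {P : Mat D m} {x : Carrier} → (∀ i → P i i ≈ x) →
                         (∀ i j → i ≢ j → P i j ≈ 0#) → _≈M_ D P (scalarM D x)
  scalarM-fromDiagonal diag offdiag i j with i ≟ j
  ... | yes refl = diag i
  ... | no  i≢j  = offdiag i j i≢j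

  invertible-row≉0 : (P : Mat D m) → IsInvertible D P → (i : Fin m) → ¬ (∀ l → P i l ≈ 0#)
  invertible-row≉0 P (Q , PQ≈1 , _) i row≈0 = 1≉0 (begin
    1#                              ≈⟨ ≈-sym (idM-diag i) ⟩
    idM D i i                       ≈⟨ ≈-sym (PQ≈1 i i) ⟩
    sumF D (λ l → P i l * Q l i)    ≈⟨ sumF-zero (λ l → ≈-trans (*-congʳ (row≈0 l)) (zeroˡ _)) ⟩
    0#                              ∎)

  *-cancelˡ : ∀ {a x y} → ¬ (a ≈ 0#) → a * x ≈ a * y → x ≈ y
  *-cancelˡ {a} {x} {y} a≉0 ax≈ay = begin
    x                 ≈⟨ ≈-sym (*-identityˡ x) ⟩
    1# * x            ≈⟨ *-congʳ (≈-sym (inverseˡ a a≉0)) ⟩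
    (a ⁻¹ * a) * x    ≈⟨ *-assoc _ _ _ ⟩
    a ⁻¹ * (a * x)    ≈⟨ *-congˡ ax≈ay ⟩
    a ⁻¹ * (a * y)    ≈⟨ ≈-sym (*-assoc _ _ _) ⟩
    (a ⁻¹ * a) * y    ≈⟨ *-congʳ (inverseˡ a a≉0) ⟩
    1# * y            ≈⟨ *-identityˡ y ⟩
    y                 ∎

  module _ {θ : Carrier → Carrier} (homo : RingMorphisms.IsRingHomomorphism rawRing rawRing θ) where
    open RingMorphisms.IsRingHomomorphism homo

    homo-idM : (i j : Fin m) → θ (idM D i j) ≈ idM D i j
    homo-idM i j with i ≟ j
    ... | yes _ = 1#-homo
    ... | no  _ = 0#-homo

    homo-shearVector : ∀ (i j : Fin m) a l → θ (idM D j l + idM D i l * a) ≈ idM D j l + idM D i l * θ a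
    homo-shearVector i j a l =
      ≈-trans (+-homo _ _) (+-cong (homo-idM j l) (≈-trans (*-homo _ _) (*-congʳ (homo-idM i l))))

  applyM-cong : (P : Mat D m) {u v : Vect D m} → (∀ l → u l ≈ v l) → ∀ r → applyM D P u r ≈ applyM D P v r
  applyM-cong P u≈v r = sumF-cong (λ l → *-congˡ {P r l} (u≈v l))

  applyM-shearVector : (P : Mat D m) (i j : Fin m) (x : Carrier) →
    ∀ r → applyM D P (λ l → idM D j l + idM D i l * x) r ≈ P r j + P r i * x
  applyM-shearVector P i j x r = begin
    sumF D (λ l → P r l * (idM D j l + idM D i l * x))
      ≈⟨ sumF-cong (λ l → ≈-trans (distribˡ (P r l) _ _) (+-congˡ (≈-sym (*-assoc (P r l) _ _)))) ⟩
    sumF D (λ l → P r l * idM D j l + (P r l * idM D i l) * x)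
      ≈⟨ sumF-distrib-+ (λ l → P r l * idM D j l) (λ l → (P r l * idM D i l) * x) ⟩
    sumF D (λ l → P r l * idM D j l) + sumF D (λ l → (P r l * idM D i l) * x)
      ≈⟨ +-congˡ (sumF-distribʳ-* (λ l → P r l * idM D i l) x) ⟩
    sumF D (λ l → P r l * idM D j l) + sumF D (λ l → P r l * idM D i l) * x
      ≈⟨ +-cong (sumF-*-idM (P r) j) (*-congʳ (sumF-*-idM (P r) i)) ⟩
    P r j + P r i * x ∎

  linComb : (Fin k → Vect D m) → (Fin k → Carrier) → Vect D m
  linComb b a r = sumF D (λ t → b t r * a t)

  Span : (Fin k → Vect D m) → Pred (Vect D m) (c ⊔ ℓ)
  Span b v = Σ (Fin _ → Carrier) λ a → ∀ r → v r ≈ linComb b a r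

  span-isSubspace : (b : Fin k → Vect D m) → IsSubspace D (Span b)
  span-isSubspace b = record
    { resp  = λ u≈v (a , u≈ba) → a , λ r → ≈-trans (≈-sym (u≈v r)) (u≈ba r)
    ; zero∈ = (λ _ → 0#) , λ r → ≈-sym (sumF-zero (λ t → zeroʳ (b t r)))
    ; +∈    = λ (a , u≈ba) (a′ , v≈ba′) → (λ t → a t + a′ t) , λ r → begin
        _ + _                                                    ≈⟨ +-cong (u≈ba r) (v≈ba′ r) ⟩
        linComb b a r + linComb b a′ r                           ≈⟨ sumF-distrib-+ (λ t → b t r * a t) (λ t → b t r * a′ t) ⟨
        sumF D (λ t → b t r * a t + b t r * a′ t)                ≈⟨ sumF-cong (λ t → distribˡ (b t r) (a t) (a′ t)) ⟨
        linComb b (λ t → a t + a′ t) r                           ∎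
    ; *∈    = λ x (a , v≈ba) → (λ t → a t * x) , λ r → begin
        _ * x                                                    ≈⟨ *-congʳ (v≈ba r) ⟩
        linComb b a r * x                                        ≈⟨ sumF-distribʳ-* (λ t → b t r * a t) x ⟨
        sumF D (λ t → (b t r * a t) * x)                         ≈⟨ sumF-cong (λ t → *-assoc (b t r) (a t) x) ⟩
        linComb b (λ t → a t * x) r                              ∎
    }

  basis-∈-span : (b : Fin k → Vect D m) (u : Fin k) → b u ∈ Span b
  basis-∈-span b u = idM D u , λ r → ≈-sym (sumF-*-idM (λ t → b t r) u)

  record HasPivots (b : Fin k → Vect D m) (g : Fin k → Fin m) : Set ℓ where
    field pivot : ∀ t u → b t (g u) ≈ idM D t u

  linComb-pivot : {b : Fin k → Vect D m} {g : Fin k → Fin m} → HasPivots b g →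
                  ∀ a u → linComb b a (g u) ≈ a u
  linComb-pivot pivots a u = ≈-trans (sumF-cong (λ t → *-congʳ (HasPivots.pivot pivots t u))) (sumF-idM-* a u)

  span-hasDim : {b : Fin k → Vect D m} {g : Fin k → Fin m} → HasPivots b g → HasDim D k (Span b)
  span-hasDim {b = b} {g} pivots =
    b , basis-∈-span b
      , (λ a ba≈0 u → ≈-trans (≈-sym (linComb-pivot pivots a u)) (ba≈0 (g u)))
      , (λ _ v∈ → v∈)

  -- Rows of idM serve as the unit vectors: shearBasis i a g is e_{g 0} + e_i a, e_{g 1}, …, e_{g k}.
  shearBasis : Fin m → Carrier → (Fin (ℕ.suc k) → Fin m) → Fin (ℕ.suc k) → Vect D m
  shearBasis i a g zero    l = idM D (g zero) l + idM D i l * a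
  shearBasis i a g (suc t) l = idM D (g (suc t)) l

  module _ {i : Fin m} {a : Carrier} {g : Fin (ℕ.suc k) → Fin m}
           (g-inj : Injective _≡_ _≡_ g) (g≢i : ∀ t → g t ≢ i) where

    shearBasis-pivots : HasPivots (shearBasis i a g) g
    shearBasis-pivots = record { pivot = pivot }
      where
      pivot : ∀ t u → shearBasis i a g t (g u) ≈ idM D t u
      pivot zero u = begin
        idM D (g zero) (g u) + idM D i (g u) * a  ≈⟨ +-congˡ (*-congʳ (idM-offdiag (g≢i u ∘ sym))) ⟩
        idM D (g zero) (g u) + 0# * a             ≈⟨ +-congˡ (zeroˡ a) ⟩
        idM D (g zero) (g u) + 0#                 ≈⟨ +-identityʳ _ ⟩
        idM D (g zero) (g u)                      ≈⟨ idM-reindex g-inj zero u ⟩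
        idM D zero u                              ∎
      pivot (suc t) u = idM-reindex g-inj (suc t) u

    linComb-shearBasis-at : ∀ b → linComb (shearBasis i a g) b i ≈ a * b zero
    linComb-shearBasis-at b = begin
      linComb (shearBasis i a g) b i                  ≈⟨ sumF-single (λ t → shearBasis i a g t i * b t) zero vanish ⟩
      (idM D (g zero) i + idM D i i * a) * b zero     ≈⟨ *-congʳ (+-cong (idM-offdiag (g≢i zero)) (*-congʳ (idM-diag i))) ⟩
      (0# + 1# * a) * b zero                          ≈⟨ *-congʳ (≈-trans (+-identityˡ _) (*-identityˡ a)) ⟩
      a * b zero                                      ∎
      where
      vanish : ∀ t → t ≢ zero → shearBasis i a g t i * b t ≈ 0#
      vanish zero    0≢0 = ⊥-elim (0≢0 refl)
      vanish (suc t) _   = ≈-trans (*-congʳ (idM-offdiag (g≢i (suc t)))) (zeroˡ (b (suc t)))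

    span-shearBasis-relation : ∀ v → v ∈ Span (shearBasis i a g) → v i ≈ a * v (g zero)
    span-shearBasis-relation v (b , v≈) = begin
      v i                                        ≈⟨ v≈ i ⟩
      linComb (shearBasis i a g) b i             ≈⟨ linComb-shearBasis-at b ⟩
      a * b zero                                 ≈⟨ *-congˡ (linComb-pivot shearBasis-pivots b zero) ⟨
      a * linComb (shearBasis i a g) b (g zero)  ≈⟨ *-congˡ (v≈ (g zero)) ⟨
      a * v (g zero)                             ∎

  injection-avoiding : ∀ {k m} → k ≤ m → (i j : Fin (ℕ.suc (ℕ.suc m))) → i ≢ j →
    Σ (Fin (ℕ.suc k) → Fin (ℕ.suc (ℕ.suc m))) λ g →
      Injective _≡_ _≡_ g × (∀ t → g t ≢ i) × g zero ≡ j
  injection-avoiding {k} {m} k≤m i j i≢j =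
    punchIn i ∘ h , h-inj ∘ punchIn-injective i _ _ , (λ t → punchInᵢ≢i i (h t)) , punchIn-punchOut i≢j
    where
    h : Fin (ℕ.suc k) → Fin (ℕ.suc m)
    h zero    = punchOut i≢j
    h (suc t) = punchIn (punchOut i≢j) (inject≤ t k≤m)

    h-inj : Injective _≡_ _≡_ h
    h-inj {zero}  {zero}  _  = refl
    h-inj {zero}  {suc u} eq = ⊥-elim (punchInᵢ≢i _ _ (sym eq))
    h-inj {suc t} {zero}  eq = ⊥-elim (punchInᵢ≢i _ _ eq)
    h-inj {suc t} {suc u} eq = cong suc (inject≤-injective _ _ t u (punchIn-injective _ _ _ eq))

  stable⇒shearEquation : {P : Mat D (ℕ.suc (ℕ.suc m))} {θ : Carrier → Carrier} →
    RingMorphisms.IsRingHomomorphism rawRing rawRing θ → k ≤ m →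
    (∀ V → IsSubspace D V → HasDim D (ℕ.suc k) V → StableUnder D P θ V) →
    ∀ i j → i ≢ j → ∀ a → P i j + P i i * θ a ≈ a * (P j j + P j i * θ a)
  stable⇒shearEquation {P = P} {θ} homo k≤m stable i j i≢j a
    with injection-avoiding k≤m i j i≢j
  ... | g , g-inj , g≢i , refl = begin
    P i (g zero) + P i i * θ a                       ≈⟨ w-entries i ⟨
    w i                                              ≈⟨ span-shearBasis-relation g-inj g≢i w w∈span ⟩
    a * w (g zero)                                   ≈⟨ *-congˡ (w-entries (g zero)) ⟩
    a * (P (g zero) (g zero) + P (g zero) i * θ a)   ∎
    where
    b = shearBasis i a g
    w = applyM D P (θ ∘ b zero)

    w∈span : w ∈ Span b
    w∈span = proj₁ (stable (Span b) (span-isSubspace b) (span-hasDim (shearBasis-pivots g-inj g≢i)))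
                   (b zero) (basis-∈-span b zero)

    w-entries : ∀ r → w r ≈ P r (g zero) + P r i * θ a
    w-entries r = ≈-trans (applyM-cong P (homo-shearVector homo i (g zero) a) r)
                          (applyM-shearVector P i (g zero) (θ a) r)

  module _ {P : Mat D m} {θ : Carrier → Carrier}
           (homo : RingMorphisms.IsRingHomomorphism rawRing rawRing θ)
           (shearEquation : ∀ i j → i ≢ j → ∀ a → P i j + P i i * θ a ≈ a * (P j j + P j i * θ a)) where
    open RingMorphisms.IsRingHomomorphism homo using (0#-homo; 1#-homo)

    shearEquation⇒offDiagonal≈0 : ∀ i j → i ≢ j → P i j ≈ 0#
    shearEquation⇒offDiagonal≈0 i j i≢j = begin
      P i j                          ≈⟨ +-identityʳ _ ⟨
      P i j + 0#                     ≈⟨ +-congˡ (≈-trans (*-congˡ 0#-homo) (zeroʳ _)) ⟨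
      P i j + P i i * θ 0#           ≈⟨ shearEquation i j i≢j 0# ⟩
      0# * (P j j + P j i * θ 0#)    ≈⟨ zeroˡ _ ⟩
      0#                             ∎

    shearEquation⇒twisted : ∀ i j → i ≢ j → ∀ a → P i i * θ a ≈ a * P j j
    shearEquation⇒twisted i j i≢j a = begin
      P i i * θ a                    ≈⟨ +-identityˡ _ ⟨
      0# + P i i * θ a               ≈⟨ +-congʳ (shearEquation⇒offDiagonal≈0 i j i≢j) ⟨
      P i j + P i i * θ a            ≈⟨ shearEquation i j i≢j a ⟩
      a * (P j j + P j i * θ a)      ≈⟨ *-congˡ (+-congˡ (*-congʳ (shearEquation⇒offDiagonal≈0 j i (i≢j ∘ sym)))) ⟩
      a * (P j j + 0# * θ a)         ≈⟨ *-congˡ (+-congˡ (zeroˡ _)) ⟩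
      a * (P j j + 0#)               ≈⟨ *-congˡ (+-identityʳ _) ⟩
      a * P j j                      ∎

    shearEquation⇒diagonal≈ : ∀ i j → i ≢ j → P i i ≈ P j j
    shearEquation⇒diagonal≈ i j i≢j = begin
      P i i           ≈⟨ *-identityʳ _ ⟨
      P i i * 1#      ≈⟨ *-congˡ 1#-homo ⟨
      P i i * θ 1#    ≈⟨ shearEquation⇒twisted i j i≢j 1# ⟩
      1# * P j j      ≈⟨ *-identityˡ _ ⟩
      P j j           ∎

lemma2p4 : ∀ {c ℓ s} (D : DivisionRing c ℓ) → FinDimOverℚ D →
    (n : ℕ) → 2 ≤ n →
    (S : Pred (DivisionRing.Carrier D → DivisionRing.Carrier D) s) → IsSigma D n S →
    (P : Mat D n) → IsInvertible D P →
    (θ : DivisionRing.Carrier D → DivisionRing.Carrier D) → θ ∈ S →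
    (k : ℕ) → 1 ≤ k → k < n →
    (∀ (V : Pred (Vect D n) _) → IsSubspace D V → HasDim D k V → StableUnder D P θ V) →
    IsCentralHomothety D P × (∀ (A : Mat D n) → _≈M_ D (Ext D θ A) A)
lemma2p4 D _ (ℕ.suc (ℕ.suc m)) (s≤s (s≤s z≤n)) S sig P P-inv θ θ∈S (ℕ.suc k) (s≤s z≤n) (s≤s (s≤s k≤m)) stable =
  (μ , μ-central , μ≉0 , scalarM-fromDiagonal D diagonal≈μ offDiagonal≈0) , σ≈id
  where
  open DivisionRing D using (Carrier; _≈_; _*_; 0#; *-congˡ; *-congʳ)
    renaming (refl to ≈-refl; sym to ≈-sym; trans to ≈-trans)
  homo = RingMorphisms.IsRingIsomorphism.isRingHomomorphism (IsSigma.isAut sig θ θ∈S)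
  shearEquation = stable⇒shearEquation D homo k≤m stable
  offDiagonal≈0 = shearEquation⇒offDiagonal≈0 D homo shearEquation

  μ : Carrier
  μ = P zero zero

  diagonal≈μ : ∀ i → P i i ≈ μ
  diagonal≈μ zero    = ≈-refl
  diagonal≈μ (suc i) = shearEquation⇒diagonal≈ D homo shearEquation (suc i) zero (λ ())

  twisted : ∀ a → μ * θ a ≈ a * μ
  twisted a = ≈-trans (*-congʳ (≈-sym (diagonal≈μ (suc zero))))
                    (shearEquation⇒twisted D homo shearEquation (suc zero) zero (λ ()) a)

  μ≉0 : ¬ (μ ≈ 0#)
  μ≉0 μ≈0 = invertible-row≉0 D P P-inv zero row₀≈0
    where
    row₀≈0 : ∀ l → P zero l ≈ 0#
    row₀≈0 zero    = μ≈0
    row₀≈0 (suc l) = offDiagonal≈0 zero (suc l) (λ ())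

  σ≈id : ∀ A → _≈M_ D (Ext D θ A) A
  σ≈id = IsSigma.unique sig θ (λ x → x) θ∈S (IsSigma.idInS sig)
           (λ x x-central → *-cancelˡ D μ≉0 (≈-trans (twisted x) (x-central μ)))

  μ-central : Central D μ
  μ-central y = ≈-trans (*-congˡ (≈-sym (σ≈id (λ _ _ → y) zero zero))) (twisted y)
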